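{- Let $A[1\ldots n]$ be an array of reals and let $\mathcal{P}=(p_1,\ldots,p_m)$, $p_k=(x_k,y_k)$, be the sequence of breakpoints of the linear interpolation of $A$, with slopes $\alpha_k$, as described in the context. Then, during the execution of the procedure $\mathsf{LeftLinearWave}(i,j,\alpha)$ described in the context, every point from which a ray shooting process starts is either the point $(i,A[i])$ or a point of $\mathcal{P}$ that is active.
   Context: The linear interpolation of $A$ is the function on $[1,n]$ that is linear between consecutive integers and equals $A[k]$ at each integer $k$. $\mathcal{P}=(p_1,\ldots,p_m)$ with $x_1=1<x_2<\dots<x_m=n$ and $y_k=A[x_k]$ is the set of endpoints of the maximal linear segments of this interpolation; $\ell_k$ is the segment from $p_k$ to $p_{k+1}$ and $\alpha_k$ its slope. A point $p_z$ is active if $z\in\{1,m\}$ or $\alpha_z>\alpha_{z-1}$; otherwise it is passive. Procedure $\mathsf{LeftLinearWave}(i,j,\alpha)$ for integers $1\le i<j\le n$ and real $\alpha$: first, if $i$ (resp. $j$) is not the $x$-coordinate of a point of the sequence, the point $(i,A[i])$ (resp. $(j,A[j])$) is inserted, splitting the segment containing it (possibly with further breakpoints at neighbouring integers; these do not change the interpolated function). Write $p_a=(i,A[i])$ and $p_{b+1}=(j,A[j])$ in the current sequence, and set the current index $c=a$. Repeat: let $z$ be the minimal index in $[c\ldots b]$ with $\alpha_z>\alpha$ (slopes with respect to the current sequence); if none exists, stop. Otherwise perform a ray shooting process from $p_z$: let $r(x)=y_z+\alpha(x-x_z)$ and let $z'$ be the minimal index in $[z+1\ldots b+1]$ with $y_{z'}<r(x_{z'})$.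 If $z'$ exists, let $x^*$ be the $x$-coordinate of the intersection of $r$ with $\ell_{z'-1}$; remove $p_{z+1},\ldots,p_{z'-1}$, insert the point $(\lfloor x^*\rfloor, r(\lfloor x^*\rfloor))$ and, if $x^*$ is not an integer, also the point $(\lceil x^*\rceil,\ell_{z'-1}(\lceil x^*\rceil))$; then continue the loop with $c$ equal to the index of the point $p_{z'}$. If $z'$ does not exist, remove $p_{z+1},\ldots,p_{b+1}$, insert $(j,r(j))$ and stop. The new array $A$ consists of the values at integers of the piecewise linear function defined by the resulting sequence. -}

module Defs where

open import Level using (0ℓ)
open import Data.Nat as ℕ using (ℕ; zero; suc; _≤?_; _≟_)
open import Data.Product using (Σ; ∃; ∃-syntax; _×_; _,_; proj₁; proj₂)
open import Data.Sum using (_⊎_)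
open import Data.List using (List; []; _∷_; _++_; _∷ʳ_; map; filter; applyUpTo)
open import Data.Maybe using (Maybe; just; nothing)
open import Relation.Nullary using (¬_; Dec; yes; no; ¬?)
open import Relation.Nullary.Decidable using (_⊎-dec_)
open import Relation.Binary.PropositionalEquality using (_≡_; _≢_)
open import Algebra.Structures using (IsCommutativeRing)
open import Relation.Binary.Structures using (IsStrictTotalOrder)

record OrderedField : Set₁ where
  infixl 6 _+_
  infixl 7 _*_
  infix  8 -_
  infix  9 _⁻¹
  infix  4 _<_
  field
    Carrier : Set
    _+_ _*_ : Carrier → Carrier → Carrier
    -_      : Carrier → Carrier
    0# 1#   : Carrier
    _⁻¹     : Carrier → Carrier
    _<_     : Carrier → Carrier → Set
    isCommutativeRing  : IsCommutativeRing _≡_ _+_ _*_ -_ 0# 1#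
    isStrictTotalOrder : IsStrictTotalOrder _≡_ _<_
    0≢1       : 0# ≢ 1#
    ⁻¹-inverse : ∀ x → x ≢ 0# → x * x ⁻¹ ≡ 1#
    +-mono-<   : ∀ {x y} z → x < y → x + z < y + z
    *-pos      : ∀ {x y} → 0# < x → 0# < y → 0# < x * y

module Wave (F : OrderedField) where
  open OrderedField F
  open IsStrictTotalOrder isStrictTotalOrder using (_<?_) renaming (_≟_ to _≟F_)

  infixl 6 _-_
  _-_ : Carrier → Carrier → Carrier
  a - b = a + (- b)

  _≤F_ : Carrier → Carrier → Set
  a ≤F b = a < b ⊎ a ≡ b

  fromℕ : ℕ → Carrier
  fromℕ zero    = 0#
  fromℕ (suc k) = 1# + fromℕ k

  Pt : Set
  Pt = ℕ × Carrier

  px : Pt → ℕ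
  px = proj₁

  py : Pt → Carrier
  py = proj₂

  slope : Pt → Pt → Carrier
  slope p q = (py q - py p) * (fromℕ (px q) - fromℕ (px p)) ⁻¹

  lineAt : Pt → Pt → Carrier → Carrier
  lineAt u w X = py u + slope u w * (X - fromℕ (px u))

  ray : Carrier → Pt → Carrier → Carrier
  ray α p X = py p + α * (X - fromℕ (px p))

  -- The breakpoint sequence P of the linear interpolation of A on [1,n]:
  -- k is an endpoint of a maximal linear segment iff k = 1, k = n, or the
  -- slope changes at k (the interpolation has slope A[k+1]-A[k] on [k,k+1]).

  IsBreak : (n : ℕ) (A : ℕ → Carrier) → ℕ → Set
  IsBreak n A k = k ≡ 1 ⊎ k ≡ n ⊎ ¬ (A k - A (k ℕ.∸ 1) ≡ A (suc k) - A k)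

  isBreak? : (n : ℕ) (A : ℕ → Carrier) → (k : ℕ) → Dec (IsBreak n A k)
  isBreak? n A k = (k ≟ 1) ⊎-dec (k ≟ n) ⊎-dec ¬? (A k - A (k ℕ.∸ 1) ≟F A (suc k) - A k)

  oneTo : ℕ → List ℕ
  oneTo n = applyUpTo suc n

  pointOf : (A : ℕ → Carrier) → ℕ → Pt
  pointOf A k = (k , A k)

  breakpoints : (n : ℕ) (A : ℕ → Carrier) → List Pt
  breakpoints n A = map (pointOf A) (filter (isBreak? n A) (oneTo n))

  Active : List Pt → Pt → Set
  Active ps p =
    Σ (List Pt) λ pre → Σ (List Pt) λ post →
      (ps ≡ pre ++ (p ∷ post)) ×
      (pre ≡ [] ⊎ post ≡ [] ⊎
        (Σ (List Pt) λ pre′ → Σ Pt λ u → Σ Pt λ q → Σ (List Pt) λ post′ →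
           (pre ≡ pre′ ∷ʳ u) × (post ≡ q ∷ post′) × (slope u p < slope p q)))

  initSeq : (n : ℕ) (A : ℕ → Carrier) (i j : ℕ) → List Pt
  initSeq n A i j =
    map (pointOf A) (filter (λ k → isBreak? n A k ⊎-dec (k ≟ i) ⊎-dec (k ≟ j)) (oneTo n))

  -- the part strictly before p_a = (i, A[i]), and the part from p_a on
  -- (p_c is always the head of the second part)
  initPre : (n : ℕ) (A : ℕ → Carrier) (i j : ℕ) → List Pt
  initPre n A i j = filter (λ p → suc (px p) ≤? i) (initSeq n A i j)

  initRest : (n : ℕ) (A : ℕ → Carrier) (i j : ℕ) → List Pt
  initRest n A i j = filter (λ p → i ≤? px p) (initSeq n A i j)

  -- Ray shooting from p (with slope α), bounded by x ≤ j:
  -- scans the points after p, remembering the previous point u;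
  -- returns (p_{z'-1}, p_{z'}, points after p_{z'}) for the minimal z' with
  -- x_{z'} ≤ j and y_{z'} < r(x_{z'}), or nothing if no such z' exists.
  shoot : Carrier → ℕ → Pt → Pt → List Pt → Maybe (Pt × Pt × List Pt)
  shoot α j p u [] = nothing
  shoot α j p u (w ∷ ws) with px w ≤? j
  ... | no _ = nothing
  ... | yes _ with py w <? ray α p (fromℕ (px w))
  ...   | yes _ = just (u , w , ws)
  ...   | no _  = shoot α j p w ws

  -- The points inserted after a successful ray shooting from p, where the
  -- ray hits ℓ_{z'-1} (from u to w) at x* = X with ⌊X⌋ = k:
  -- (k, r(k)), and, if X is not an integer, (k+1, ℓ_{z'-1}(k+1)) unless
  -- k+1 = x_{z'} (then that point is p_{z'} itself, already present).
  data NewPoints (α : Carrier) (p u w : Pt) (X : Carrier) (k : ℕ) : List Pt → Set where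
    integral : X ≡ fromℕ k →
               NewPoints α p u w X k ((k , ray α p (fromℕ k)) ∷ [])
    ceilIsW  : X ≢ fromℕ k → suc k ≡ px w →
               NewPoints α p u w X k ((k , ray α p (fromℕ k)) ∷ [])
    twoPts   : X ≢ fromℕ k → suc k ℕ.< px w →
               NewPoints α p u w X k
                 ((k , ray α p (fromℕ k)) ∷ (suc k , lineAt u w (fromℕ (suc k))) ∷ [])

  -- RayStart α j pre rest s : in the main loop, with current sequence
  -- pre ++ rest and p_c the head of rest, a ray shooting process is
  -- (eventually) started from the point s.
  data RayStart (α : Carrier) (j : ℕ) : List Pt → List Pt → Pt → Set where
    -- p_c has x_c < j and α_c ≤ α: z is further right
    skip : ∀ {pre p q rs s} →
           px p ℕ.< j → ¬ (α < slope p q) →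
           RayStart α j (pre ∷ʳ p) (q ∷ rs) s →
           RayStart α j pre (p ∷ q ∷ rs) s
    here : ∀ {pre p q rs} →
           px p ℕ.< j → α < slope p q →
           RayStart α j pre (p ∷ q ∷ rs) p
    -- z = c, the ray shooting finds z', and the loop continues at p_{z'}
    next : ∀ {pre p q rs u w ws X k new s} →
           px p ℕ.< j → α < slope p q →
           shoot α j p p (q ∷ rs) ≡ just (u , w , ws) →
           lineAt u w X ≡ ray α p X →
           fromℕ k ≤F X → X < fromℕ (suc k) →
           NewPoints α p u w X k new →
           RayStart α j (pre ++ (p ∷ new)) (w ∷ ws) s →
           RayStart α j pre (p ∷ q ∷ rs) s

  RayStartPoint : (n : ℕ) (A : ℕ → Carrier) (i j : ℕ) (α : Carrier) → Pt → Set
  RayStartPoint n A i j α s = RayStart α j (initPre n A i j) (initRest n A i j) s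

-- The points still to be examined by the main loop always form a suffix of the
-- initial sequence (the points inserted by a ray shooting go to the part already
-- passed), and consecutive points of that suffix bound a single linear piece of A;
-- hence the slope at p_c is the unit increment Δ(x_c) = A[x_c + 1] − A[x_c].
-- The loop keeps the invariant "p_c = (i, A[i]) or Δ(x_c − 1) ≤ α": skipping p_c
-- means Δ(x_c) ≤ α, and after a ray shooting p_{z'−1} lies on or above the ray
-- while p_{z'} lies strictly below it, so the piece between them has slope at most α.
-- A ray shot from p_z ≠ (i, A[i]) therefore has Δ(x_z − 1) ≤ α < Δ(x_z): the slope
-- of the interpolation strictly increases at x_z, which makes p_z active in 𝒫.

module Submission where

open import Defs
open import Data.Nat using (ℕ; _≤_; _<_)
open import Data.Product using (_,_)
open import Data.Sum using (_⊎_)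
open import Relation.Binary.PropositionalEquality using (_≡_)

open import Algebra.Bundles using (CommutativeRing)
import Data.Nat as ℕ
open import Data.Nat using (zero; suc; z≤n; s≤s; _∸_; _≤′_; ≤′-refl; ≤′-step; _≤?_; _≟_)
open import Data.Nat.Properties
  using (≤-refl; ≤-trans; ≤-reflexive; <⇒≤; <⇒≱; <-trans; ≰⇒>; n<1+n; <-cmp; m≤n⇒m≤1+n; m≤n⇒m<n∨m≡n;
         ≤⇒≤′; ≤′⇒≤; +-∸-assoc; n∸n≡0; m+[n∸m]≡n; m<n⇒0<n∸m)
open import Data.Empty using (⊥-elim)
open import Data.List using (List; []; _∷_; _++_; _∷ʳ_; map; filter; applyUpTo)
open import Data.List.Properties using (filter-accept; filter-reject; map-++)
open import Data.Maybe using (just)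
open import Data.Maybe.Properties using (just-injective)
open import Data.Product using (Σ-syntax; _×_)
open import Data.Sum using (inj₁; inj₂)
open import Data.Unit using (⊤; tt)
open import Function using (_∘_)
open import Relation.Binary.Definitions using (tri<; tri≈; tri>)
open import Relation.Binary.PropositionalEquality
  using (_≢_; refl; sym; trans; cong; cong₂; subst; subst₂; module ≡-Reasoning)
open import Relation.Binary.Structures using (IsStrictTotalOrder)
open import Relation.Nullary using (¬_; yes; no)
open import Relation.Nullary.Decidable using (_⊎-dec_; decidable-stable)
open import Relation.Unary using (Pred; Decidable)

filter-map : ∀ {a b p} {A : Set a} {B : Set b} {P : Pred B p} (P? : Decidable P) (f : A → B) xs →
             filter P? (map f xs) ≡ map f (filter (P? ∘ f) xs)
filter-map P? f []       = refl
filter-map P? f (x ∷ xs) with P? (f x)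
... | yes _ = cong (f x ∷_) (filter-map P? f xs)
... | no  _ = filter-map P? f xs

map-∷ʳ-++ : ∀ {a b} {A : Set a} {B : Set b} (f : A → B) xs x ys →
            map f (xs ∷ʳ x ++ ys) ≡ map f xs ∷ʳ f x ++ map f ys
map-∷ʳ-++ f xs x ys = trans (map-++ f (xs ∷ʳ x) ys) (cong (_++ map f ys) (map-++ f xs (x ∷ [])))

Free : (ℕ → Set) → ℕ → ℕ → Set
Free P lo hi = ∀ {k} → lo ≤ k → k < hi → ¬ P k

data Enumerates (P : ℕ → Set) (lo hi : ℕ) : List ℕ → Set where
  []   : Free P lo hi → Enumerates P lo hi []
  cons : ∀ {a ks} → lo ≤ a → a < hi → P a → Free P lo a → Enumerates P (suc a) hi ks →
         Enumerates P lo hi (a ∷ ks)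

f0<f[1+m] : ∀ {f : ℕ → ℕ} → (∀ k → f (suc k) ≡ suc (f k)) → ∀ m → f 0 < f (suc m)
f0<f[1+m] f-step zero    = ≤-reflexive (sym (f-step 0))
f0<f[1+m] f-step (suc m) = <-trans (f0<f[1+m] f-step m) (≤-reflexive (sym (f-step (suc m))))

module _ {P : ℕ → Set} where

  free-empty : ∀ {lo} → Free P lo lo
  free-empty lo≤k k<lo = ⊥-elim (<⇒≱ k<lo lo≤k)

  free-extend : ∀ {lo hi} → ¬ P lo → Free P (suc lo) hi → Free P lo hi
  free-extend ¬Plo free lo≤k k<hi with m≤n⇒m<n∨m≡n lo≤k
  ... | inj₁ lo<k = free lo<k k<hi
  ... | inj₂ refl = ¬Plo

  enumerates-extend : ∀ {lo hi ks} → ¬ P lo → Enumerates P (suc lo) hi ks → Enumerates P lo hi ks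
  enumerates-extend ¬Plo ([] free)                  = [] (free-extend ¬Plo free)
  enumerates-extend ¬Plo (cons lo<a a<hi Pa free e) = cons (<⇒≤ lo<a) a<hi Pa (free-extend ¬Plo free) e

  enumerates-filter-applyUpTo : (P? : Decidable P) {f : ℕ → ℕ} → (∀ k → f (suc k) ≡ suc (f k)) →
                                ∀ m → Enumerates P (f 0) (f m) (filter P? (applyUpTo f m))
  enumerates-filter-applyUpTo P? f-step zero = [] free-empty
  enumerates-filter-applyUpTo P? {f} f-step (suc m)
    with P? (f 0) | subst (λ lo → Enumerates P lo (f (suc m)) (filter P? (applyUpTo (f ∘ suc) m)))
                          (f-step 0) (enumerates-filter-applyUpTo P? (f-step ∘ suc) m)
  ... | yes Pf0 | rest = cons ≤-refl (f0<f[1+m] f-step m) Pf0 free-empty rest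
  ... | no ¬Pf0 | rest = enumerates-extend ¬Pf0 rest

  filter-≤?-all : ∀ {lo hi ks m} → m ≤ lo → Enumerates P lo hi ks → filter (m ≤?_) ks ≡ ks
  filter-≤?-all m≤lo ([] _)                 = refl
  filter-≤?-all m≤lo (cons {a} lo≤a _ _ _ e) = trans
    (filter-accept (_ ≤?_) (≤-trans m≤lo lo≤a))
    (cong (a ∷_) (filter-≤?-all (m≤n⇒m≤1+n (≤-trans m≤lo lo≤a)) e))

  enumerates-filter-≤? : ∀ {lo hi ks m} → lo ≤ m → Enumerates P lo hi ks →
                         Enumerates P m hi (filter (m ≤?_) ks)
  enumerates-filter-≤? lo≤m ([] free) = [] (free ∘ ≤-trans lo≤m)
  enumerates-filter-≤? {m = m} lo≤m (cons {a} lo≤a a<hi Pa free e) with m ≤? a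
  ... | yes m≤a = subst (Enumerates P m _) (sym (filter-accept (m ≤?_) m≤a))
                    (cons m≤a a<hi Pa (free ∘ ≤-trans lo≤m)
                      (subst (Enumerates P (suc a) _) (sym (filter-≤?-all (m≤n⇒m≤1+n m≤a) e)) e))
  ... | no  m≰a = subst (Enumerates P m _) (sym (filter-reject (m ≤?_) m≰a))
                    (enumerates-filter-≤? (≰⇒> m≰a) e)

  enumerates-tail : ∀ {lo hi a ks} → Enumerates P lo hi (a ∷ ks) → Enumerates P (suc a) hi ks
  enumerates-tail (cons _ _ _ _ e) = e

  enumerates-head : ∀ {lo hi a ks} → Enumerates P lo hi (a ∷ ks) → P lo → a ≡ lo
  enumerates-head (cons lo≤a _ _ free _) Plo with m≤n⇒m<n∨m≡n lo≤a
  ... | inj₁ lo<a = ⊥-elim (free ≤-refl lo<a Plo)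
  ... | inj₂ lo≡a = sym lo≡a

  data Preceded (lo x : ℕ) : List ℕ → Set where
    first : Free P lo x → Preceded lo x []
    after : ∀ {pre u} → u < x → Free P (suc u) x → Preceded lo x (pre ∷ʳ u)

  enumerates-split : ∀ {lo hi ks x} → Enumerates P lo hi ks → lo ≤ x → x < hi → P x →
                     Σ[ pre ∈ List ℕ ] Σ[ post ∈ List ℕ ]
                       ks ≡ pre ++ x ∷ post × Preceded lo x pre × Enumerates P (suc x) hi post
  enumerates-split ([] free) lo≤x x<hi Px = ⊥-elim (free lo≤x x<hi Px)
  enumerates-split {x = x} (cons {a} {ks} lo≤a _ Pa free e) lo≤x x<hi Px with <-cmp a x
  ... | tri≈ _ refl _ = [] , ks , refl , first free , e
  ... | tri> _ _ x<a  = ⊥-elim (free lo≤x x<a Px)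
  ... | tri< a<x _ _ with enumerates-split e a<x x<hi Px
  ...   | _ , post , eq , first free′ , e′ =
    a ∷ [] , post , cong (a ∷_) eq , after {pre = []} a<x free′ , e′
  ...   | _ , post , eq , after {pre} u<x free′ , e′ =
    a ∷ pre ∷ʳ _ , post , cong (a ∷_) eq , after {pre = a ∷ pre} u<x free′ , e′

module OrderedFieldProperties (F : OrderedField) where
  open OrderedField F renaming (_<_ to _<F_)
  open IsStrictTotalOrder isStrictTotalOrder using (compare; irrefl; asym) renaming (trans to <F-trans)
  open Wave F using (_-_; fromℕ; px; py; slope; ray)
  open ≡-Reasoning

  commutativeRing : CommutativeRing _ _
  commutativeRing = record { isCommutativeRing = isCommutativeRing }

  open CommutativeRing commutativeRing
    using (ring; +-assoc; +-comm; +-identityˡ; +-identityʳ; -‿inverseˡ; -‿inverseʳ;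
           *-assoc; *-identityʳ; zeroʳ; distribˡ; distribʳ)
  open import Algebra.Properties.Ring ring using (-1*x≈-x; -‿involutive; xyx⁻¹≈y)

  [x+y]-x≡y : ∀ x y → (x + y) - x ≡ y
  [x+y]-x≡y = xyx⁻¹≈y

  [y-x]+x≡y : ∀ x y → (y - x) + x ≡ y
  [y-x]+x≡y x y = begin
    (y + - x) + x  ≡⟨ +-assoc y (- x) x ⟩
    y + (- x + x)  ≡⟨ cong (y +_) (-‿inverseˡ x) ⟩
    y + 0#         ≡⟨ +-identityʳ y ⟩
    y              ∎

  x+[y-x]≡y : ∀ x y → x + (y - x) ≡ y
  x+[y-x]≡y x y = trans (+-comm x (y - x)) ([y-x]+x≡y x y)

  [x-y]+[y-z]≡x-z : ∀ x y z → (x - y) + (y - z) ≡ x - z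
  [x-y]+[y-z]≡x-z x y z = begin
    (x + - y) + (y + - z)  ≡⟨ +-assoc x (- y) (y + - z) ⟩
    x + (- y + (y + - z))  ≡⟨ cong (x +_) (+-assoc (- y) y (- z)) ⟨
    x + ((- y + y) + - z)  ≡⟨ cong (λ t → x + (t + - z)) (-‿inverseˡ y) ⟩
    x + (0# + - z)         ≡⟨ cong (x +_) (+-identityˡ (- z)) ⟩
    x + - z                ∎

  [x+dc]+d≡x+d[1+c] : ∀ x d c → (x + d * c) + d ≡ x + d * (1# + c)
  [x+dc]+d≡x+d[1+c] x d c = begin
    (x + d * c) + d         ≡⟨ +-assoc x (d * c) d ⟩
    x + (d * c + d)         ≡⟨ cong (x +_) (+-comm (d * c) d) ⟩
    x + (d + d * c)         ≡⟨ cong (λ t → x + (t + d * c)) (*-identityʳ d) ⟨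
    x + (d * 1# + d * c)    ≡⟨ cong (x +_) (distribˡ d 1# c) ⟨
    x + d * (1# + c)        ∎

  x+d0≡x : ∀ x d → x + d * 0# ≡ x
  x+d0≡x x d = trans (cong (x +_) (zeroʳ d)) (+-identityʳ x)

  0<1 : 0# <F 1#
  0<1 with compare 0# 1#
  ... | tri< 0<1 _ _ = 0<1
  ... | tri≈ _ 0≡1 _ = ⊥-elim (0≢1 0≡1)
  ... | tri> _ _ 1<0 = ⊥-elim (asym 1<0 (subst (0# <F_) [-1][-1]≡1 (*-pos 0<-1 0<-1)))
    where
    [-1][-1]≡1 : - 1# * - 1# ≡ 1#
    [-1][-1]≡1 = trans (-1*x≈-x (- 1#)) (-‿involutive 1#)
    0<-1 : 0# <F - 1#
    0<-1 = subst₂ _<F_ (-‿inverseʳ 1#) (+-identityˡ (- 1#)) (+-mono-< (- 1#) 1<0)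

  +-monoʳ-< : ∀ z {x y} → x <F y → z + x <F z + y
  +-monoʳ-< z {x} {y} x<y = subst₂ _<F_ (+-comm x z) (+-comm y z) (+-mono-< z x<y)

  *-monoˡ-< : ∀ {c x y} → 0# <F c → x <F y → x * c <F y * c
  *-monoˡ-< {c} {x} {y} 0<c x<y = subst₂ _<F_ (+-identityˡ (x * c)) [y-x]c+xc≡yc
    (+-mono-< (x * c) (*-pos (subst (_<F y - x) (-‿inverseʳ x) (+-mono-< (- x) x<y)) 0<c))
    where
    [y-x]c+xc≡yc : (y - x) * c + x * c ≡ y * c
    [y-x]c+xc≡yc = trans (sym (distribʳ c (y - x) x)) (cong (_* c) ([y-x]+x≡y x y))

  ≯-<-trans : ∀ {x y z} → ¬ (y <F x) → y <F z → x <F z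
  ≯-<-trans {x} {y} y≮x y<z with compare x y
  ... | tri< x<y _ _ = <F-trans x<y y<z
  ... | tri≈ _ refl _ = y<z
  ... | tri> _ _ y<x = ⊥-elim (y≮x y<x)

  slope-≯-of-crossing : ∀ {y r s α c} → 0# <F c → ¬ (y <F r) → y + s * c <F r + α * c → ¬ (α <F s)
  slope-≯-of-crossing {y} {r} {s} {α} {c} 0<c y≮r below α<s with compare y r
  ... | tri< y<r _ _ = y≮r y<r
  ... | tri≈ _ refl _ = asym below (+-monoʳ-< y (*-monoˡ-< 0<c α<s))
  ... | tri> _ _ r<y = asym below (<F-trans (+-monoʳ-< r (*-monoˡ-< 0<c α<s)) (+-mono-< (s * c) r<y))

  fromℕ-+ : ∀ a b → fromℕ (a ℕ.+ b) ≡ fromℕ a + fromℕ b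
  fromℕ-+ zero    b = sym (+-identityˡ (fromℕ b))
  fromℕ-+ (suc a) b = trans (cong (1# +_) (fromℕ-+ a b)) (sym (+-assoc 1# (fromℕ a) (fromℕ b)))

  fromℕ-∸ : ∀ {a b} → a ≤ b → fromℕ b - fromℕ a ≡ fromℕ (b ∸ a)
  fromℕ-∸ {a} {b} a≤b = begin
    fromℕ b - fromℕ a                    ≡⟨ cong (λ t → fromℕ t - fromℕ a) (m+[n∸m]≡n a≤b) ⟨
    fromℕ (a ℕ.+ (b ∸ a)) - fromℕ a      ≡⟨ cong (_- fromℕ a) (fromℕ-+ a (b ∸ a)) ⟩
    (fromℕ a + fromℕ (b ∸ a)) - fromℕ a  ≡⟨ [x+y]-x≡y (fromℕ a) (fromℕ (b ∸ a)) ⟩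
    fromℕ (b ∸ a)                        ∎

  0<fromℕ : ∀ {m} → 0 < m → 0# <F fromℕ m
  0<fromℕ {suc zero}    _ = subst (0# <F_) (sym (+-identityʳ 1#)) 0<1
  0<fromℕ {suc (suc m)} _ = <F-trans (0<fromℕ {suc m} (s≤s z≤n)) x<1+x
    where
    x<1+x : fromℕ (suc m) <F 1# + fromℕ (suc m)
    x<1+x = subst (_<F 1# + fromℕ (suc m)) (+-identityˡ _) (+-mono-< (fromℕ (suc m)) 0<1)

  slope-of-rise : ∀ {a b} y d → a < b → slope (a , y) (b , y + d * fromℕ (b ∸ a)) ≡ d
  slope-of-rise {a} {b} y d a<b = begin
    ((y + d * c) - y) * (fromℕ b - fromℕ a) ⁻¹  ≡⟨ cong₂ (λ u v → u * v ⁻¹) ([x+y]-x≡y y (d * c))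
                                                                         (fromℕ-∸ (<⇒≤ a<b)) ⟩
    (d * c) * c ⁻¹                              ≡⟨ *-assoc d c (c ⁻¹) ⟩
    d * (c * c ⁻¹)                              ≡⟨ cong (d *_) (⁻¹-inverse c c≢0) ⟩
    d * 1#                                      ≡⟨ *-identityʳ d ⟩
    d                                           ∎
    where
    c = fromℕ (b ∸ a)
    c≢0 : c ≢ 0#
    c≢0 c≡0 = irrefl refl (subst (0# <F_) c≡0 (0<fromℕ (m<n⇒0<n∸m a<b)))

  ray-shift : ∀ α p X Y → ray α p Y ≡ ray α p X + α * (Y - X)
  ray-shift α p X Y = begin
    py p + α * (Y - x)                    ≡⟨ cong (λ t → py p + α * t) ([x-y]+[y-z]≡x-z Y X x) ⟨
    py p + α * ((Y - X) + (X - x))        ≡⟨ cong (py p +_) (distribˡ α (Y - X) (X - x)) ⟩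
    py p + (α * (Y - X) + α * (X - x))    ≡⟨ cong (py p +_) (+-comm (α * (Y - X)) (α * (X - x))) ⟩
    py p + (α * (X - x) + α * (Y - X))    ≡⟨ +-assoc (py p) (α * (X - x)) (α * (Y - X)) ⟨
    (py p + α * (X - x)) + α * (Y - X)    ∎
    where x = fromℕ (px p)

  ray-base : ∀ α p → ray α p (fromℕ (px p)) ≡ py p
  ray-base α p = trans (cong (λ t → py p + α * t) (-‿inverseʳ (fromℕ (px p)))) (x+d0≡x (py p) α)

module Interpolation (F : OrderedField) (n : ℕ) (A : ℕ → OrderedField.Carrier F) where
  open OrderedField F renaming (_<_ to _<F_)
  open IsStrictTotalOrder isStrictTotalOrder using (irrefl) renaming (_≟_ to _≟F_)
  open Wave F
  open OrderedFieldProperties F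
  open ≡-Reasoning

  pt : ℕ → Pt
  pt = pointOf A

  Δ : ℕ → Carrier
  Δ k = A (suc k) - A k

  Unbroken : ℕ → ℕ → Set
  Unbroken a b = Free (IsBreak n A) (suc a) b

  Δ-step : ∀ {k} → ¬ IsBreak n A (suc k) → Δ k ≡ Δ (suc k)
  Δ-step {k} ¬break = decidable-stable (Δ k ≟F Δ (suc k)) (¬break ∘ inj₂ ∘ inj₂)

  Δ-unbroken : ∀ {a b k} → Unbroken a b → a ≤′ k → k < b → Δ k ≡ Δ a
  Δ-unbroken _  ≤′-refl             _     = refl
  Δ-unbroken ub (≤′-step {k} a≤′k) 1+k<b = trans
    (sym (Δ-step (ub (s≤s (≤′⇒≤ a≤′k)) 1+k<b)))
    (Δ-unbroken ub a≤′k (<-trans (n<1+n k) 1+k<b))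

  Δ-pred-unbroken : ∀ {a b} → a < b → Unbroken a b → Δ (b ∸ 1) ≡ Δ a
  Δ-pred-unbroken {b = suc b} (s≤s a≤b) ub = Δ-unbroken ub (≤⇒≤′ a≤b) ≤-refl

  A-unbroken : ∀ {a b} → a ≤ b → Unbroken a b → A b ≡ A a + Δ a * fromℕ (b ∸ a)
  A-unbroken {a} {b} a≤b ub = go (≤⇒≤′ a≤b) ≤-refl
    where
    go : ∀ {c} → a ≤′ c → c ≤ b → A c ≡ A a + Δ a * fromℕ (c ∸ a)
    go ≤′-refl _ = begin
      A a                        ≡⟨ x+d0≡x (A a) (Δ a) ⟨
      A a + Δ a * 0#             ≡⟨ cong (λ m → A a + Δ a * fromℕ m) (n∸n≡0 a) ⟨
      A a + Δ a * fromℕ (a ∸ a)  ∎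
    go (≤′-step {c} a≤′c) 1+c≤b = begin
      A (suc c)                          ≡⟨ x+[y-x]≡y (A c) (A (suc c)) ⟨
      A c + Δ c                          ≡⟨ cong₂ _+_ (go a≤′c (<⇒≤ 1+c≤b)) (Δ-unbroken ub a≤′c 1+c≤b) ⟩
      (A a + Δ a * fromℕ (c ∸ a)) + Δ a  ≡⟨ [x+dc]+d≡x+d[1+c] (A a) (Δ a) (fromℕ (c ∸ a)) ⟩
      A a + Δ a * fromℕ (suc (c ∸ a))    ≡⟨ cong (λ m → A a + Δ a * fromℕ m) (+-∸-assoc 1 (≤′⇒≤ a≤′c)) ⟨
      A a + Δ a * fromℕ (suc c ∸ a)      ∎

  slope-unbroken : ∀ {a b} → a < b → Unbroken a b → slope (pt a) (pt b) ≡ Δ a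
  slope-unbroken {a} {b} a<b ub = trans
    (cong (λ y → slope (pt a) (b , y)) (A-unbroken (<⇒≤ a<b) ub))
    (slope-of-rise (A a) (Δ a) a<b)

  Δ-≯-at-crossing : ∀ {a b} α p → a < b → Unbroken a b →
                    ¬ (A a <F ray α p (fromℕ a)) → A b <F ray α p (fromℕ b) → ¬ (α <F Δ a)
  Δ-≯-at-crossing {a} {b} α p a<b ub above below =
    slope-≯-of-crossing (0<fromℕ (m<n⇒0<n∸m a<b)) above
                        (subst₂ _<F_ (A-unbroken (<⇒≤ a<b) ub) ray-b below)
    where
    ray-b : ray α p (fromℕ b) ≡ ray α p (fromℕ a) + α * fromℕ (b ∸ a)
    ray-b = trans (ray-shift α p (fromℕ a) (fromℕ b))
                  (cong (λ t → ray α p (fromℕ a) + α * t) (fromℕ-∸ (<⇒≤ a<b)))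

  breakpoints-enumerates : Enumerates (IsBreak n A) 1 (suc n) (filter (isBreak? n A) (oneTo n))
  breakpoints-enumerates = enumerates-filter-applyUpTo (isBreak? n A) (λ _ → refl) n

  active-of-Δ-increase : ∀ {a} → a ≤ n → Δ (a ∸ 1) <F Δ a → Active (breakpoints n A) (pt a)
  active-of-Δ-increase {zero} _ Δ0<Δ0 = ⊥-elim (irrefl refl Δ0<Δ0)
  active-of-Δ-increase {suc a} 1+a≤n Δ<Δ
    with enumerates-split breakpoints-enumerates (s≤s z≤n) (s≤s 1+a≤n) (inj₂ (inj₂ (λ eq → irrefl eq Δ<Δ)))
  ... | _ , post , eq , first _ , _ =
    [] , map pt post , cong (map pt) eq , inj₁ refl
  ... | _ , [] , eq , after {pre} {u} _ _ , _ =
    map pt pre ∷ʳ pt u , [] , trans (cong (map pt) eq) (map-∷ʳ-++ pt pre u _) , inj₂ (inj₁ refl)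
  ... | _ , q ∷ post , eq , after {pre} {u} u<a ub , cons a<q _ _ ub′ _ =
    map pt pre ∷ʳ pt u , pt q ∷ map pt post , trans (cong (map pt) eq) (map-∷ʳ-++ pt pre u _) ,
    inj₂ (inj₂ (map pt pre , pt u , pt q , map pt post , refl , refl , slope-increase))
    where
    slope-increase : slope (pt u) (pt (suc a)) <F slope (pt (suc a)) (pt q)
    slope-increase = subst₂ _<F_
      (trans (Δ-pred-unbroken u<a ub) (sym (slope-unbroken u<a ub)))
      (sym (slope-unbroken a<q ub′))
      Δ<Δ

module LeftLinearWave (F : OrderedField) (n : ℕ) (A : ℕ → OrderedField.Carrier F)
                      (i j : ℕ) (α : OrderedField.Carrier F) where
  open OrderedField F renaming (_<_ to _<F_)
  open IsStrictTotalOrder isStrictTotalOrder using (irrefl) renaming (_<?_ to _<F?_)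
  open Wave F
  open OrderedFieldProperties F
  open Interpolation F n A

  InInitSeq : ℕ → Set
  InInitSeq k = IsBreak n A k ⊎ k ≡ i ⊎ k ≡ j

  inInitSeq? : Decidable InInitSeq
  inInitSeq? k = isBreak? n A k ⊎-dec (k ≟ i) ⊎-dec (k ≟ j)

  Conclusion : Pt → Set
  Conclusion s = s ≡ (i , A i) ⊎ Active (breakpoints n A) s

  Admissible : ℕ → Set
  Admissible a = a ≡ i ⊎ ¬ (α <F Δ (a ∸ 1))

  LoopInvariant : List ℕ → Set
  LoopInvariant []      = ⊤
  LoopInvariant (a ∷ _) = Admissible a

  unbroken-consecutive : ∀ {a b ks} → Enumerates InInitSeq (suc a) (suc n) (b ∷ ks) →
                         a < b × Unbroken a b
  unbroken-consecutive (cons a<b _ _ free _) = a<b , λ a<k k<b → free a<k k<b ∘ inj₁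

  data Hit (p : Pt) : Pt × Pt × List Pt → Set where
    hit : ∀ {a b ks} → Enumerates InInitSeq (suc a) (suc n) (b ∷ ks) →
          ¬ (A a <F ray α p (fromℕ a)) → A b <F ray α p (fromℕ b) →
          Hit p (pt a , pt b , map pt ks)

  shoot-hit : ∀ {p a ks r} → Enumerates InInitSeq (suc a) (suc n) ks →
              ¬ (A a <F ray α p (fromℕ a)) → shoot α j p (pt a) (map pt ks) ≡ just r → Hit p r
  shoot-hit {ks = []} _ _ ()
  shoot-hit {p} {ks = b ∷ ks} e above shot with b ≤? j
  shoot-hit {p} {ks = b ∷ ks} e above () | no _
  ... | yes _ with A b <F? ray α p (fromℕ b)
  ...   | yes below = subst (Hit p) (just-injective shot) (hit e above below)
  ...   | no ¬below = shoot-hit (enumerates-tail e) ¬below shot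

  admissible-next : ∀ {a b} → a < b → Unbroken a b → ¬ (α <F Δ a) → Admissible b
  admissible-next a<b ub α≮Δ = inj₂ (α≮Δ ∘ subst (α <F_) (Δ-pred-unbroken a<b ub))

  conclusion-at-start : ∀ {a} → a ≤ n → α <F Δ a → Admissible a → Conclusion (pt a)
  conclusion-at-start _   _   (inj₁ refl)   = inj₁ refl
  conclusion-at-start a≤n α<Δ (inj₂ α≮Δ′) = inj₂ (active-of-Δ-increase a≤n (≯-<-trans α≮Δ′ α<Δ))

  module _ (j≤n : j ≤ n) where

    conclusion-of-RayStart : ∀ {lo pre ks s} → RayStart α j pre (map pt ks) s →
                             Enumerates InInitSeq lo (suc n) ks → LoopInvariant ks → Conclusion s
    conclusion-of-RayStart {ks = []}     ()
    conclusion-of-RayStart {ks = _ ∷ []} ()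
    conclusion-of-RayStart {ks = a ∷ b ∷ ks} (skip _ α≮slope rs) e _
      with unbroken-consecutive (enumerates-tail e)
    ... | a<b , ub = conclusion-of-RayStart rs (enumerates-tail e)
      (admissible-next a<b ub (α≮slope ∘ subst (α <F_) (sym (slope-unbroken a<b ub))))
    conclusion-of-RayStart {ks = a ∷ b ∷ ks} (here a<j α<slope) e inv
      with unbroken-consecutive (enumerates-tail e)
    ... | a<b , ub = conclusion-at-start (≤-trans (<⇒≤ a<j) j≤n)
      (subst (α <F_) (slope-unbroken a<b ub) α<slope) inv
    conclusion-of-RayStart {ks = a ∷ b ∷ ks} (next _ _ shot _ _ _ _ rs) e _
      with shoot-hit (enumerates-tail e) (irrefl (sym (ray-base α (pt a)))) shot
    ... | hit e′ above below with unbroken-consecutive e′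
    ...   | a′<b′ , ub′ = conclusion-of-RayStart rs e′
      (admissible-next a′<b′ ub′ (Δ-≯-at-crossing α (pt a) a′<b′ ub′ above below))

    loopInvariant-initial : ∀ {ks} → Enumerates InInitSeq i (suc n) ks → LoopInvariant ks
    loopInvariant-initial ([] _)            = tt
    loopInvariant-initial e@(cons _ _ _ _ _) = inj₁ (enumerates-head e (inj₂ (inj₁ refl)))

    conclusion-of-RayStartPoint : 1 ≤ i → ∀ {s} → RayStartPoint n A i j α s → Conclusion s
    conclusion-of-RayStartPoint 1≤i {s} rs =
      conclusion-of-RayStart rs′ initial (loopInvariant-initial initial)
      where
      rs′ : RayStart α j (initPre n A i j) (map pt (filter (i ≤?_) (filter inInitSeq? (oneTo n)))) s
      rs′ = subst (λ rest → RayStart α j (initPre n A i j) rest s)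
                  (filter-map (λ p → i ≤? px p) pt (filter inInitSeq? (oneTo n))) rs
      initial : Enumerates InInitSeq i (suc n) (filter (i ≤?_) (filter inInitSeq? (oneTo n)))
      initial = enumerates-filter-≤? 1≤i (enumerates-filter-applyUpTo inInitSeq? (λ _ → refl) n)

mainTheorem8 : (F : OrderedField) (n : ℕ) (A : ℕ → OrderedField.Carrier F)
               (i j : ℕ) → 1 ≤ i → i < j → j ≤ n →
               (α : OrderedField.Carrier F) (s : Wave.Pt F) →
               Wave.RayStartPoint F n A i j α s →
               (s ≡ (i , A i)) ⊎ Wave.Active F (Wave.breakpoints F n A) s
mainTheorem8 F n A i j 1≤i _ j≤n α s = LeftLinearWave.conclusion-of-RayStartPoint F n A i j α j≤n 1≤i
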